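{- Let $\sigma$ be a well-shaped state of type $(1,1,c_2,d_2)$ with $c_2\ge2$. For every integer $0\le d\le d_2$ there exists a $4$-interval question $Q$ of type $[1,0,2,d]$ in $\sigma$ such that both resulting states $\sigma_{yes}$ and $\sigma_{no}$ are well shaped.
   Context: Setting: $\mathcal U=\{0,\dots,2^m-1\}$, viewed cyclically, and the game allows $3$ lies. States: a state is a map $\sigma:\mathcal U\to\{0,\dots,4\}$ of type $(|\sigma^{ -1}(0)|,\dots,|\sigma^{ -1}(3)|)$. Its support is $\Sigma=\{y:\sigma(y)\le3\}$. Answers: $\sigma_{yes}(y)=\min\{\sigma(y)+[y\notin Q],4\}$ and $\sigma_{no}(y)=\min\{\sigma(y)+[y\in Q],4\}$. Question type: the type of $Q$ in $\sigma$ is $[|Q\cap\sigma^{ -1}(i)|]_{i=0..3}$. Intervals: an interval is empty or a set of cyclically consecutive elements of $\mathcal U$. A $4$-interval question is a union of at most four intervals. Well shaped: order $\Sigma$ cyclically. The state is well shaped if $\Sigma$ splits into twelve possibly empty sets of cyclically consecutive elements of $\Sigma$, in cyclic order, on which $\sigma$ is constant with values either $2,1,0,1,2,3,2,1,2,3,2,3$ or $2,1,0,1,2,1,2,3,2,3,2,3$. -}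

module Defs where

open import Data.Nat using (ℕ; zero; suc; _+_; _∸_; _^_; _≤_; _<ᵇ_; _≤ᵇ_; _≡ᵇ_; _⊓_)
open import Data.Bool using (Bool; true; false; if_then_else_; not; _∨_)
open import Data.Fin using (Fin; toℕ)
open import Data.List using (List; []; _∷_; map; filter; length; drop; take; _++_; concat; replicate; allFin)
open import Data.Vec using (Vec; []; _∷_; toList; zipWith)
import Data.Vec as Vec
open import Data.Product using (Σ; _×_; _,_; ∃; proj₁; proj₂)
open import Relation.Binary.PropositionalEquality using (_≡_)
open import Relation.Nullary.Decidable using (Dec)
open import Data.Nat using (_≟_; _≤?_)
open import Data.Bool using (T)
open import Data.Bool.Properties using (T?)

-- Universe U = {0,...,2^m - 1} is Fin (2 ^ m); cyclic order is the order of toℕ, wrapped.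
U : ℕ → Set
U m = Fin (2 ^ m)

-- A state: values in {0,...,4}; the bound σ y ≤ 4 is imposed as a hypothesis.
State : ℕ → Set
State m = U m → ℕ

Question : ℕ → Set
Question m = U m → Bool

elems : (m : ℕ) → List (U m)
elems m = allFin (2 ^ m)

count : (m : ℕ) → (U m → Bool) → ℕ
count m P = length (filter (λ y → T? (P y)) (elems m))

stateType : (m : ℕ) → State m → Vec ℕ 4
stateType m σ = Vec.map (λ i → count m (λ y → σ y ≡ᵇ i)) (0 ∷ 1 ∷ 2 ∷ 3 ∷ [])

questionType : (m : ℕ) → State m → Question m → Vec ℕ 4
questionType m σ Q = Vec.map (λ i → count m (λ y → Q y Data.Bool.∧ (σ y ≡ᵇ i))) (0 ∷ 1 ∷ 2 ∷ 3 ∷ [])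

[_] : Bool → ℕ
[ true ] = 1
[ false ] = 0

σyes : (m : ℕ) → State m → Question m → State m
σyes m σ Q y = (σ y + [ not (Q y) ]) ⊓ 4

σno : (m : ℕ) → State m → Question m → State m
σno m σ Q y = (σ y + [ Q y ]) ⊓ 4

cycDist : (m : ℕ) → U m → U m → ℕ
cycDist m a y = if toℕ a ≤ᵇ toℕ y then toℕ y ∸ toℕ a else (toℕ y + 2 ^ m) ∸ toℕ a

-- the cyclic interval starting at a of length k: {a, a+1, ..., a+k-1} (mod 2^m);
-- k = 0 gives the empty interval.
inInterval : (m : ℕ) → U m × ℕ → U m → Bool
inInterval m (a , k) y = cycDist m a y <ᵇ k

-- Q is a union of (at most) four intervals (empty intervals allowed)
IsFourInterval : (m : ℕ) → Question m → Set
IsFourInterval m Q =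
  Σ (Vec (U m × ℕ) 4) λ ivs →
    (∀ y → Q y ≡ Data.List.foldr _∨_ false (map (λ iv → inInterval m iv y) (toList ivs)))

support : (m : ℕ) → State m → List (U m)
support m σ = filter (λ y → σ y ≤? 3) (elems m)

pattern₁ pattern₂ : Vec ℕ 12
pattern₁ = 2 ∷ 1 ∷ 0 ∷ 1 ∷ 2 ∷ 3 ∷ 2 ∷ 1 ∷ 2 ∷ 3 ∷ 2 ∷ 3 ∷ []
pattern₂ = 2 ∷ 1 ∷ 0 ∷ 1 ∷ 2 ∷ 1 ∷ 2 ∷ 3 ∷ 2 ∷ 3 ∷ 2 ∷ 3 ∷ []

blocks : Vec ℕ 12 → Vec ℕ 12 → List ℕ
blocks ℓ p = concat (toList (zipWith replicate ℓ p))

-- Well shaped: after a cyclic rotation of the (cyclically ordered) support, the values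
-- of σ along it consist of twelve consecutive (possibly empty) constant blocks with
-- values given by pattern₁ or pattern₂.
WellShaped : (m : ℕ) → State m → Set
WellShaped m σ =
  Σ ℕ λ r → Σ (Vec ℕ 12) λ ℓ →
    let s = support m σ
        vals = map σ (drop r s ++ take r s)
    in (vals ≡ blocks ℓ pattern₁) Data.Sum.⊎ (vals ≡ blocks ℓ pattern₂)
  where import Data.Sum

-- The question is assembled block by
-- block: the cell of value 0, no cell of value 1, d cells at the ends of the three blocks of value 3,
-- and two cells at the ends of blocks of value 2 chosen according to which of them are nonempty
-- (fifteen cases). Every block is thereby cut into at most two segments, and whether the question is
-- a union of four cyclic intervals and whether both answers are well shaped depends only on the
-- values and the membership of the segments, not on their lengths; so it is decided by evaluation,
-- once for each of the thirty combinations of pattern and case. Consecutive support elements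
-- starting at a form an interval: they are the support elements whose cyclic distance from a is
-- below that of the next support element.

module Submission where

open import Defs
open import Data.Bool using (Bool; true; false; T; not; _∧_; _∨_; if_then_else_)
open import Data.Bool.Properties using (T-∨; T-∧)
open import Data.Empty using (⊥-elim)
open import Data.Fin using (toℕ; fromℕ<)
open import Data.Fin.Properties using (toℕ<n)
open import Data.List using (List; []; _∷_; _++_; map; filter; length; take; drop; concat; replicate; upTo; foldr)
open import Data.Bool.ListAction using (any)
open import Data.List.Properties
open import Data.List.Relation.Unary.All as All using (All; []; _∷_)
import Data.List.Relation.Unary.All.Properties as All
open import Data.List.Relation.Unary.AllPairs as AllPairs using (AllPairs; []; _∷_)
import Data.List.Relation.Unary.AllPairs.Properties as AllPairs
open import Data.List.Relation.Unary.Any using (satisfied)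
open import Data.List.Relation.Unary.Any.Properties using (any⁻)
open import Data.Nat using (ℕ; zero; suc; _+_; _∸_; _^_; _⊓_; _≤_; _<_; _≤?_; _≡ᵇ_; _<ᵇ_; _≤ᵇ_; z≤n; s≤s)
open import Data.Nat.Properties
open import Data.Product using (Σ; ∃; ∃₂; _×_; _,_; proj₁; proj₂)
open import Data.Sum using (_⊎_; inj₁; inj₂)
open import Data.Unit using (⊤; tt)
open import Data.Vec using (Vec; []; _∷_; toList; zipWith)
open import Data.Vec.Relation.Binary.Pointwise.Inductive using (Pointwise; []; _∷_)
import Data.Vec as Vec
open import Function using (_∘_)
open import Function.Bundles using (Equivalence)
open import Relation.Binary.PropositionalEquality hiding ([_])
open import Relation.Nullary using (yes; no; does)
open import Relation.Nullary.Decidable using (T?)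
open import Relation.Unary using (Decidable)

private variable
  A B : Set
  n : ℕ

replicate-+ : ∀ k l (x : A) → replicate (k + l) x ≡ replicate k x ++ replicate l x
replicate-+ zero l x = refl
replicate-+ (suc k) l x = cong (x ∷_) (replicate-+ k l x)

map-filter : (f : A → B) {P : B → Set} (P? : Decidable P) (xs : List A) →
             map f (filter (P? ∘ f) xs) ≡ filter P? (map f xs)
map-filter f P? [] = refl
map-filter f P? (x ∷ xs) with does (P? (f x))
... | true = cong (f x ∷_) (map-filter f P? xs)
... | false = map-filter f P? xs

filter-filter-⊆ : {P Q : A → Set} (P? : Decidable P) (Q? : Decidable Q) → (∀ {x} → P x → Q x) →
                  (xs : List A) → filter P? (filter Q? xs) ≡ filter P? xs
filter-filter-⊆ P? Q? P⇒Q [] = refl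
filter-filter-⊆ P? Q? P⇒Q (x ∷ xs) with P? x | Q? x
... | yes px | yes _ = trans (filter-accept P? px) (cong (x ∷_) (filter-filter-⊆ P? Q? P⇒Q xs))
... | yes px | no ¬qx = ⊥-elim (¬qx (P⇒Q px))
... | no ¬px | yes _ = trans (filter-reject P? ¬px) (filter-filter-⊆ P? Q? P⇒Q xs)
... | no _ | no _ = filter-filter-⊆ P? Q? P⇒Q xs

map-≡-replicate : (g : A → B) (c : B) {w : List A} → All (λ y → g y ≡ c) w → map g w ≡ replicate (length w) c
map-≡-replicate g c [] = refl
map-≡-replicate g c (e ∷ es) = cong₂ _∷_ e (map-≡-replicate g c es)

length-filter-constant : (p : A → Bool) (c : Bool) {w : List A} → All (λ y → p y ≡ c) w →
                         length (filter (λ y → T? (p y)) w) ≡ (if c then length w else 0)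
length-filter-constant p true all = cong length (filter-all (λ y → T? (p y)) (All.map (λ e → subst T (sym e) tt) all))
length-filter-constant p false all = cong length (filter-none (λ y → T? (p y)) (All.map (λ e → subst T e) all))

AllPairs-++⁻ : {R : A → A → Set} (xs : List A) {ys : List A} → AllPairs R (xs ++ ys) →
               AllPairs R xs × AllPairs R ys × All (λ x → All (R x) ys) xs
AllPairs-++⁻ [] rys = [] , rys , []
AllPairs-++⁻ (x ∷ xs) (rx ∷ rxs) with AllPairs-++⁻ xs rxs
... | rxs′ , rys , cross = All.++⁻ˡ xs rx ∷ rxs′ , rys , All.++⁻ʳ xs rx ∷ cross

AllPairs-restrict : {P : A → Set} {R S : A → A → Set} → (∀ {x y} → P x → P y → R x y → S x y) →
                    {xs : List A} → All P xs → AllPairs R xs → AllPairs S xs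
AllPairs-restrict f [] [] = []
AllPairs-restrict f (px ∷ pxs) (rx ∷ rxs) =
  All.zipWith (λ (py , r) → f px py r) (pxs , rx) ∷ AllPairs-restrict f pxs rxs

All-across : {P Q : A → Set} {S : A → A → Set} → (∀ {x y} → P x → Q y → S x y) →
             {xs ys : List A} → All P xs → All Q ys → All (λ x → All (S x) ys) xs
All-across f pxs qys = All.map (λ px → All.map (f px) qys) pxs

<ᵇ-true : ∀ {i j} → i < j → (i <ᵇ j) ≡ true
<ᵇ-true {i} {j} i<j with i <ᵇ j | <⇒<ᵇ i<j
... | true | _ = refl

<ᵇ-false : ∀ {i j} → j ≤ i → (i <ᵇ j) ≡ false
<ᵇ-false {i} {j} j≤i with i <ᵇ j | <ᵇ⇒< i j
... | false | _ = refl
... | true | i<j = ⊥-elim (<⇒≱ (i<j tt) j≤i)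

+⊓4≤3⇒≤3 : ∀ v x → (v + x) ⊓ 4 ≤ 3 → v ≤ 3
+⊓4≤3⇒≤3 v x h with v + x ≤? 3
... | yes v+x≤3 = ≤-trans (m≤m+n v x) v+x≤3
... | no v+x≰3 = ⊥-elim (<⇒≱ (s≤s (s≤s (s≤s (s≤s z≤n)))) (subst (_≤ 3) (m≥n⇒m⊓n≡n (≰⇒> v+x≰3)) h))

∷-injective₄ : {a b c d a′ b′ c′ d′ : A} → _≡_ {A = Vec A 4} (a ∷ b ∷ c ∷ d ∷ []) (a′ ∷ b′ ∷ c′ ∷ d′ ∷ []) →
               a ≡ a′ × b ≡ b′ × c ≡ c′ × d ≡ d′
∷-injective₄ refl = refl , refl , refl , refl

≤-sum-split : ∀ d (ls : Vec ℕ n) → d ≤ Vec.sum ls → Σ (Vec ℕ n) λ xs → Pointwise _≤_ xs ls × Vec.sum xs ≡ d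
≤-sum-split d [] d≤0 = [] , [] , sym (n≤0⇒n≡0 d≤0)
≤-sum-split d (l ∷ ls) d≤ with ≤-sum-split (d ∸ l) ls (m≤n+o⇒m∸n≤o d l d≤)
... | xs , xs≤ls , sum≡ = l ⊓ d ∷ xs , m⊓n≤m l d ∷ xs≤ls , trans (cong (l ⊓ d +_) sum≡) (m⊓n+n∸m≡n l d)

-- Rotations of lists

rotate : ℕ → List A → List A
rotate r xs = drop r xs ++ take r xs

infix 4 _↻_

_↻_ : List A → List A → Set
xs ↻ ys = ∃₂ λ as bs → xs ≡ as ++ bs × ys ≡ bs ++ as

↻-swap : (xs ys : List A) → (xs ++ ys) ↻ (ys ++ xs)
↻-swap xs ys = xs , ys , refl , refl

↻-rotate : ∀ r (xs : List A) → xs ↻ rotate r xs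
↻-rotate r xs = take r xs , drop r xs , sym (take++drop≡id r xs) , refl

++-split : ∀ (as bs cs ds : List A) → as ++ bs ≡ cs ++ ds →
           (∃ λ us → cs ≡ as ++ us × bs ≡ us ++ ds) ⊎ (∃ λ us → as ≡ cs ++ us × ds ≡ us ++ bs)
++-split [] bs cs ds eq = inj₁ (cs , refl , eq)
++-split (a ∷ as) bs [] ds eq = inj₂ (a ∷ as , refl , sym eq)
++-split (a ∷ as) bs (c ∷ cs) ds eq with ∷-injective eq
... | refl , eq′ with ++-split as bs cs ds eq′
...   | inj₁ (us , refl , bs≡) = inj₁ (us , refl , bs≡)
...   | inj₂ (us , refl , ds≡) = inj₂ (us , refl , ds≡)

↻-trans : {xs ys zs : List A} → xs ↻ ys → ys ↻ zs → xs ↻ zs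
↻-trans (as , bs , refl , refl) (cs , ds , eq , refl) with ++-split bs as cs ds eq
... | inj₁ (us , refl , refl) = us , ds ++ bs , ++-assoc us ds bs , sym (++-assoc ds bs us)
... | inj₂ (us , refl , refl) = as ++ cs , us , sym (++-assoc as cs us) , ++-assoc us as cs

↻-move-front : {s : List A} (xs ys zs : List A) → s ↻ ((xs ++ ys) ++ zs) → s ↻ (ys ++ zs ++ xs)
↻-move-front xs ys zs rot =
  ↻-trans rot (subst₂ _↻_ (sym (++-assoc xs ys zs)) (++-assoc ys zs xs) (↻-swap xs (ys ++ zs)))

↻-map : (f : A → B) {xs ys : List A} → xs ↻ ys → map f xs ↻ map f ys
↻-map f (as , bs , refl , refl) = map f as , map f bs , map-++ f as bs , map-++ f bs as

↻-filter : {P : A → Set} (P? : Decidable P) {xs ys : List A} → xs ↻ ys → filter P? xs ↻ filter P? ys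
↻-filter P? (as , bs , refl , refl) = filter P? as , filter P? bs , filter-++ P? as bs , filter-++ P? bs as

↻-All : {P : A → Set} {xs ys : List A} → xs ↻ ys → All P ys → All P xs
↻-All (as , bs , refl , refl) pys with All.++⁻ bs pys
... | pbs , pas = All.++⁺ pas pbs

↻-length : {xs ys : List A} → xs ↻ ys → length ys ≡ length xs
↻-length (as , bs , refl , refl) = trans (length-++ bs) (trans (+-comm (length bs) _) (sym (length-++ as)))

take-length-++ : (xs ys : List A) → take (length xs) (xs ++ ys) ≡ xs
take-length-++ [] ys = refl
take-length-++ (x ∷ xs) ys = cong (x ∷_) (take-length-++ xs ys)

drop-length-++ : (xs ys : List A) → drop (length xs) (xs ++ ys) ≡ ys
drop-length-++ [] ys = refl
drop-length-++ (x ∷ xs) ys = drop-length-++ xs ys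

↻⇒rotate : {xs ys : List A} → xs ↻ ys → ∃ λ r → rotate r xs ≡ ys
↻⇒rotate (as , bs , refl , refl) = length as , cong₂ _++_ (drop-length-++ as bs) (take-length-++ as bs)

someRotation : (List A → Bool) → List A → Bool
someRotation p xs = any (λ r → p (rotate r xs)) (upTo (length xs))

someRotation-sound : (p : List A → Bool) (xs : List A) → T (someRotation p xs) → ∃ λ r → T (p (rotate r xs))
someRotation-sound p xs h = satisfied (any⁻ (λ r → p (rotate r xs)) (upTo (length xs)) h)

map-rotate : (f : A → B) (r : ℕ) (xs : List A) → map f (rotate r xs) ≡ rotate r (map f xs)
map-rotate f r xs = trans (map-++ f (drop r xs) (take r xs)) (sym (cong₂ _++_ (drop-map r xs) (take-map r xs)))

-- Sequences of constant blocks

blocksOf : Vec ℕ n → Vec ℕ n → List ℕ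
blocksOf ℓ p = concat (toList (zipWith replicate ℓ p))

FitsPattern : Vec ℕ n → List ℕ → Set
FitsPattern p xs = ∃ λ ℓ → xs ≡ blocksOf ℓ p

FitsPattern-[] : (p : Vec ℕ n) → FitsPattern p []
FitsPattern-[] [] = [] , refl
FitsPattern-[] (q ∷ p) with FitsPattern-[] p
... | ℓ , eq = 0 ∷ ℓ , eq

FitsPattern-skip : ∀ {q} {p : Vec ℕ n} {xs} → FitsPattern p xs → FitsPattern (q ∷ p) xs
FitsPattern-skip (ℓ , eq) = 0 ∷ ℓ , eq

FitsPattern-extend : ∀ {q} {p : Vec ℕ n} {xs} k → FitsPattern (q ∷ p) xs → FitsPattern (q ∷ p) (replicate k q ++ xs)
FitsPattern-extend {q = q} k (l ∷ ℓ , refl) =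
  k + l ∷ ℓ , trans (sym (++-assoc (replicate k q) _ _)) (cong (_++ _) (sym (replicate-+ k l q)))

Run : Set
Run = ℕ × ℕ

expand : List Run → List ℕ
expand [] = []
expand ((k , v) ∷ rs) = replicate k v ++ expand rs

expand-++ : (rs ss : List Run) → expand (rs ++ ss) ≡ expand rs ++ expand ss
expand-++ [] ss = refl
expand-++ ((k , v) ∷ rs) ss = trans (cong (replicate k v ++_) (expand-++ rs ss)) (sym (++-assoc (replicate k v) _ _))

↻-expand : {rs ss : List Run} → rs ↻ ss → expand rs ↻ expand ss
↻-expand (as , bs , refl , refl) = expand as , expand bs , expand-++ as bs , expand-++ bs as

filter-expand : {P : ℕ → Set} (P? : Decidable P) (rs : List Run) →
                filter P? (expand rs) ≡ expand (filter (P? ∘ proj₂) rs)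
filter-expand P? [] = refl
filter-expand P? ((k , v) ∷ rs) with P? v
... | yes pv = trans (filter-++ P? (replicate k v) (expand rs))
                     (cong₂ _++_ (filter-all P? (All.replicate⁺ k pv)) (filter-expand P? rs))
... | no ¬pv = trans (filter-++ P? (replicate k v) (expand rs))
                     (cong₂ _++_ (filter-none P? (All.replicate⁺ k ¬pv)) (filter-expand P? rs))

fits : Vec ℕ n → List ℕ → Bool
fits p [] = true
fits [] (_ ∷ _) = false
fits (q ∷ p) (v ∷ vs) = if q ≡ᵇ v then fits (q ∷ p) vs else fits p (v ∷ vs)

fits-sound : (p : Vec ℕ n) (rs : List Run) → T (fits p (map proj₂ rs)) → FitsPattern p (expand rs)
fits-sound-∷ : (p : Vec ℕ n) (k v : ℕ) (rs : List Run) → T (fits p (v ∷ map proj₂ rs)) →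
               FitsPattern p (replicate k v ++ expand rs)

fits-sound p [] _ = FitsPattern-[] p
fits-sound p ((k , v) ∷ rs) h = fits-sound-∷ p k v rs h

fits-sound-∷ (q ∷ p) k v rs h with q ≡ᵇ v | ≡ᵇ⇒≡ q v
... | true | q≡v = subst (λ u → FitsPattern (q ∷ p) (replicate k u ++ expand rs)) (q≡v tt)
                    (FitsPattern-extend k (fits-sound (q ∷ p) rs h))
... | false | _ = FitsPattern-skip (fits-sound-∷ p k v rs h)

WellShapedValues : List ℕ → Set
WellShapedValues vs = ∃ λ ws → vs ↻ ws × (FitsPattern pattern₁ ws ⊎ FitsPattern pattern₂ ws)

↻-WellShapedValues : {vs ws : List ℕ} → vs ↻ ws → WellShapedValues ws → WellShapedValues vs
↻-WellShapedValues vs↻ws (us , ws↻us , shaped) = us , ↻-trans vs↻ws ws↻us , shaped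

fitsEither : List ℕ → Bool
fitsEither vs = fits pattern₁ vs ∨ fits pattern₂ vs

wellShaped? : List ℕ → Bool
wellShaped? = someRotation fitsEither

wellShaped?-sound : (rs : List Run) → T (wellShaped? (map proj₂ rs)) → WellShapedValues (expand rs)
wellShaped?-sound rs h with someRotation-sound fitsEither (map proj₂ rs) h
... | r , fitsʳ rewrite sym (map-rotate proj₂ r rs) with Equivalence.to T-∨ fitsʳ
...   | inj₁ f = _ , ↻-expand (↻-rotate r rs) , inj₁ (fits-sound pattern₁ (rotate r rs) f)
...   | inj₂ f = _ , ↻-expand (↻-rotate r rs) , inj₂ (fits-sound pattern₂ (rotate r rs) f)

-- Marked segments

Segment : Set → Set
Segment A = List A × Bool

flatten : List (Segment A) → List A
flatten fs = concat (map proj₁ fs)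

marks : List (Segment A) → List Bool
marks = map proj₂

flatten-++ : (fs gs : List (Segment A)) → flatten (fs ++ gs) ≡ flatten fs ++ flatten gs
flatten-++ fs gs = trans (cong concat (map-++ proj₁ fs gs)) (sym (concat-++ (map proj₁ fs) (map proj₁ gs)))

↻-flatten : {fs gs : List (Segment A)} → fs ↻ gs → flatten fs ↻ flatten gs
↻-flatten (as , bs , refl , refl) = flatten as , flatten bs , flatten-++ as bs , flatten-++ bs as

Realises : (A → Bool) → List (Segment A) → Set
Realises Q = All (λ seg → All (λ y → Q y ≡ proj₂ seg) (proj₁ seg))

-- trueRunsInRun does not count the run of trues that the list continues.
trueRuns trueRunsInRun : List Bool → ℕ
trueRuns [] = 0
trueRuns (false ∷ bs) = trueRuns bs
trueRuns (true ∷ bs) = suc (trueRunsInRun bs)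
trueRunsInRun [] = 0
trueRunsInRun (true ∷ bs) = trueRunsInRun bs
trueRunsInRun (false ∷ bs) = trueRuns bs

leadingMarked : List (Segment A) → List A
leadingMarked [] = []
leadingMarked ((w , true) ∷ fs) = w ++ leadingMarked fs
leadingMarked ((w , false) ∷ fs) = []

afterLeadingMarked : List (Segment A) → List (Segment A)
afterLeadingMarked [] = []
afterLeadingMarked ((w , true) ∷ fs) = afterLeadingMarked fs
afterLeadingMarked ((w , false) ∷ fs) = (w , false) ∷ fs

flatten-leadingMarked : (fs : List (Segment A)) → flatten fs ≡ leadingMarked fs ++ flatten (afterLeadingMarked fs)
flatten-leadingMarked [] = refl
flatten-leadingMarked ((w , true) ∷ fs) = trans (cong (w ++_) (flatten-leadingMarked fs)) (sym (++-assoc w _ _))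
flatten-leadingMarked ((w , false) ∷ fs) = refl

trueRunsInRun-afterLeadingMarked : (fs : List (Segment A)) → trueRunsInRun (marks fs) ≡ trueRuns (marks (afterLeadingMarked fs))
trueRunsInRun-afterLeadingMarked [] = refl
trueRunsInRun-afterLeadingMarked ((w , true) ∷ fs) = trueRunsInRun-afterLeadingMarked fs
trueRunsInRun-afterLeadingMarked ((w , false) ∷ fs) = refl

Realises-leadingMarked : ∀ (Q : A → Bool) fs → All (λ y → Q y ≡ true) (leadingMarked fs) →
                         Realises Q (afterLeadingMarked fs) → Realises Q fs
Realises-leadingMarked Q [] _ rest = rest
Realises-leadingMarked Q ((w , true) ∷ fs) lead rest with All.++⁻ w lead
... | inW , inFs = inW ∷ Realises-leadingMarked Q fs inFs rest
Realises-leadingMarked Q ((w , false) ∷ fs) _ rest = rest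

All-flatten⁻ : {P : A → Set} (fs : List (Segment A)) → All P (flatten fs) → All (λ seg → All P (proj₁ seg)) fs
All-flatten⁻ [] _ = []
All-flatten⁻ ((w , b) ∷ fs) pfs with All.++⁻ w pfs
... | pw , prest = pw ∷ All-flatten⁻ fs prest

cyclicTrueRunsAtMost : ℕ → List Bool → Bool
cyclicTrueRunsAtMost k = someRotation (λ bs → trueRuns bs ≤ᵇ k)

cyclicTrueRunsAtMost-sound : ∀ k (fs : List (Segment A)) → T (cyclicTrueRunsAtMost k (marks fs)) →
                             ∃ λ r → trueRuns (marks (rotate r fs)) ≤ k
cyclicTrueRunsAtMost-sound k fs h with someRotation-sound (λ bs → trueRuns bs ≤ᵇ k) (marks fs) h
... | r , atMost = r , subst (_≤ k) (cong trueRuns (sym (map-rotate proj₂ r fs))) (≤ᵇ⇒≤ _ k atMost)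

-- Cyclic intervals

module _ (m : ℕ) where

  Interval : Set
  Interval = U m × ℕ

  origin : U m
  origin = fromℕ< (m^n>0 2 m)

  unionOf : Vec Interval n → Question m
  unionOf ivs y = foldr _∨_ false (map (λ iv → inInterval m iv y) (toList ivs))

  Increasing : List (U m) → Set
  Increasing = AllPairs (λ x y → toℕ x < toℕ y)

  support-increasing : (σ : State m) → Increasing (support m σ)
  support-increasing σ = AllPairs.filter⁺ (λ y → σ y ≤? 3) (AllPairs.tabulate⁺-< (λ i<j → i<j))

  cycDist-≤ : ∀ a y → toℕ a ≤ toℕ y → cycDist m a y ≡ toℕ y ∸ toℕ a
  cycDist-≤ a y a≤y with toℕ a ≤ᵇ toℕ y in a≤ᵇy
  ... | true = refl
  ... | false = ⊥-elim (subst T a≤ᵇy (≤⇒≤ᵇ a≤y))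

  cycDist-> : ∀ a y → toℕ y < toℕ a → cycDist m a y ≡ toℕ y + 2 ^ m ∸ toℕ a
  cycDist-> a y y<a with toℕ a ≤ᵇ toℕ y in a≤ᵇy
  ... | true = ⊥-elim (<⇒≱ y<a (≤ᵇ⇒≤ (toℕ a) (toℕ y) (subst T (sym a≤ᵇy) tt)))
  ... | false = refl

  ≤+2^m : ∀ (a y : U m) → toℕ a ≤ toℕ y + 2 ^ m
  ≤+2^m a y = ≤-trans (<⇒≤ (toℕ<n a)) (m≤n+m (2 ^ m) (toℕ y))

  cycDist<2^m : ∀ a y → cycDist m a y < 2 ^ m
  cycDist<2^m a y with toℕ a ≤? toℕ y
  ... | yes a≤y rewrite cycDist-≤ a y a≤y = ≤-<-trans (m∸n≤m (toℕ y) (toℕ a)) (toℕ<n y)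
  ... | no a≰y rewrite cycDist-> a y (≰⇒> a≰y) =
    subst (toℕ y + 2 ^ m ∸ toℕ a <_) (m+n∸m≡n (toℕ a) (2 ^ m))
          (∸-monoˡ-< (+-monoˡ-< (2 ^ m) (≰⇒> a≰y)) (≤+2^m a y))

  CloserTo : U m → U m → U m → Set
  CloserTo a x y = cycDist m a x < cycDist m a y

  CloserTo-after++before : ∀ {a} D T → All (λ x → toℕ a ≤ toℕ x) D → All (λ y → toℕ y < toℕ a) T →
                      Increasing D → Increasing T → AllPairs (CloserTo a) (D ++ T)
  CloserTo-after++before {a} D T afterD beforeT incD incT =
    AllPairs.++⁺ (AllPairs-restrict after-after afterD incD) (AllPairs-restrict before-before beforeT incT)
                 (All-across after-before afterD beforeT)
    where
      after-after : ∀ {x y} → toℕ a ≤ toℕ x → toℕ a ≤ toℕ y → toℕ x < toℕ y → CloserTo a x y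
      after-after {x} {y} a≤x a≤y x<y rewrite cycDist-≤ a x a≤x | cycDist-≤ a y a≤y = ∸-monoˡ-< x<y a≤x
      before-before : ∀ {x y} → toℕ x < toℕ a → toℕ y < toℕ a → toℕ x < toℕ y → CloserTo a x y
      before-before {x} {y} x<a y<a x<y rewrite cycDist-> a x x<a | cycDist-> a y y<a =
        ∸-monoˡ-< (+-monoˡ-< (2 ^ m) x<y) (≤+2^m a x)
      after-before : ∀ {x y} → toℕ a ≤ toℕ x → toℕ y < toℕ a → CloserTo a x y
      after-before {x} {y} a≤x y<a rewrite cycDist-≤ a x a≤x | cycDist-> a y y<a =
        ∸-monoˡ-< (<-≤-trans (toℕ<n x) (m≤n+m (2 ^ m) (toℕ y))) a≤x

  -- A rotation of s that starts at a lists the elements from a on, then those before a.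
  rotation-CloserTo : ∀ {s a rest} → Increasing s → s ↻ (a ∷ rest) → AllPairs (CloserTo a) (a ∷ rest)
  rotation-CloserTo inc (as , b ∷ bs , refl , refl) with AllPairs-++⁻ as inc
  ... | incAs , b<bs ∷ incBs , cross =
    CloserTo-after++before (b ∷ bs) as (≤-refl ∷ All.map <⇒≤ b<bs) (All.map All.head cross) (b<bs ∷ incBs) incAs
  rotation-CloserTo {a = a} {rest} inc (.(a ∷ rest) , [] , refl , refl) with AllPairs-++⁻ (a ∷ rest) inc
  ... | a<rest ∷ incRest , _ , _ =
    subst (AllPairs (CloserTo a)) (++-identityʳ (a ∷ rest))
          (CloserTo-after++before (a ∷ rest) [] (≤-refl ∷ All.map <⇒≤ a<rest) [] (a<rest ∷ incRest) [])

  cycDist-threshold : ∀ a S Y → AllPairs (CloserTo a) (S ++ Y) →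
              ∃ λ k → All (λ y → cycDist m a y < k) S × All (λ y → k ≤ cycDist m a y) Y
  cycDist-threshold a S [] _ = 2 ^ m , All.universal (cycDist<2^m a) S , []
  cycDist-threshold a S (b ∷ Y) closer with AllPairs-++⁻ S closer
  ... | _ , b<Y ∷ _ , cross = cycDist m a b , All.map All.head cross , ≤-refl ∷ All.map <⇒≤ b<Y

  prefix-interval : ∀ {s} S Y → Increasing s → s ↻ (S ++ Y) →
                    ∃ λ iv → All (λ y → inInterval m iv y ≡ true) S × All (λ y → inInterval m iv y ≡ false) Y
  prefix-interval [] Y _ _ = (origin , 0) , [] , All.universal (λ _ → refl) Y
  prefix-interval (a ∷ S) Y inc rot with cycDist-threshold a (a ∷ S) Y (rotation-CloserTo inc rot)
  ... | k , inS , outY = (a , k) , All.map <ᵇ-true inS , All.map <ᵇ-false outY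

  Outside : Vec Interval n → List (U m) → Set
  Outside ivs = All (λ y → unionOf ivs y ≡ false)

  unionOf-empty : ∀ n y → unionOf (Vec.replicate n (origin , 0)) y ≡ false
  unionOf-empty zero y = refl
  unionOf-empty (suc n) y = unionOf-empty n y

  -- Each maximal run of marked segments gets an interval of its own; D collects the elements
  -- already passed, which stay outside all intervals.
  realising-intervals : ∀ {s} n (fs : List (Segment (U m))) D → Increasing s → s ↻ (flatten fs ++ D) →
          trueRuns (marks fs) ≤ n → Σ (Vec Interval n) λ ivs → Outside ivs D × Realises (unionOf ivs) fs
  realising-intervals n [] D _ _ _ = Vec.replicate n (origin , 0) , All.universal (unionOf-empty n) D , []
  realising-intervals n ((w , false) ∷ fs) D inc rot runs with realising-intervals n fs (D ++ w) inc (↻-move-front w (flatten fs) D rot) runs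
  ... | ivs , outDw , realises with All.++⁻ D outDw
  ...   | outD , outW = ivs , outD , outW ∷ realises
  realising-intervals (suc n) ((w , true) ∷ fs) D inc rot (s≤s runs) =
    extend (realising-intervals n rest (D ++ S) inc (↻-move-front S (flatten rest) D rot′)
                  (subst (_≤ n) (trueRunsInRun-afterLeadingMarked fs) runs))
           (prefix-interval S (flatten rest ++ D) inc (subst (_ ↻_) (++-assoc S (flatten rest) D) rot′))
    where
      S = leadingMarked ((w , true) ∷ fs)
      rest = afterLeadingMarked fs
      rot′ = subst (λ xs → _ ↻ (xs ++ D)) (flatten-leadingMarked ((w , true) ∷ fs)) rot

      extend : (Σ (Vec Interval n) λ ivs → Outside ivs (D ++ S) × Realises (unionOf ivs) rest) →
               (∃ λ iv → All (λ y → inInterval m iv y ≡ true) S × All (λ y → inInterval m iv y ≡ false) (flatten rest ++ D)) →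
               Σ (Vec Interval (suc n)) λ ivs → Outside ivs D × Realises (unionOf ivs) ((w , true) ∷ fs)
      extend (ivs , outDS , realises) (iv , inS , outRestD) =
        iv ∷ ivs , All.zipWith outside (outD′ , outD) ,
        Realises-leadingMarked (unionOf (iv ∷ ivs)) ((w , true) ∷ fs) (All.map inside inS)
          (All.zipWith (λ (out , real) → All.zipWith outside (out , real)) (All-flatten⁻ rest outRest , realises))
        where
          outD = proj₁ (All.++⁻ D outDS)
          outRest = proj₁ (All.++⁻ (flatten rest) outRestD)
          outD′ = proj₂ (All.++⁻ (flatten rest) outRestD)
          inside : ∀ {y} → inInterval m iv y ≡ true → unionOf (iv ∷ ivs) y ≡ true
          inside {y} p = cong (_∨ unionOf ivs y) p
          outside : ∀ {y b} → inInterval m iv y ≡ false × unionOf ivs y ≡ b → unionOf (iv ∷ ivs) y ≡ b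
          outside {y} (p , q) = trans (cong (_∨ unionOf ivs y) p) q

  four-intervals : ∀ {s} (fs : List (Segment (U m))) → Increasing s → s ↻ flatten fs →
                   T (cyclicTrueRunsAtMost 4 (marks fs)) → Σ (Vec Interval 4) λ ivs → Realises (unionOf ivs) fs
  four-intervals fs inc rot atMost with cyclicTrueRunsAtMost-sound 4 fs atMost
  ... | r , runs with realising-intervals 4 (rotate r fs) [] inc
                        (subst (_ ↻_) (sym (++-identityʳ _)) (↻-trans rot (↻-flatten (↻-rotate r fs)))) runs
  ...   | ivs , _ , realises = ivs , ↻-All (↻-rotate r fs) realises

-- Cutting the blocks of a state

data Side : Set where
  front back : Side

data Take : Set where
  skip whole : Take
  part : ℕ → Take

Cut : Set
Cut = Side × Take

takeAmount : Take → ℕ → ℕ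
takeAmount skip _ = 0
takeAmount whole l = l
takeAmount (part k) _ = k

TakeFits : Take → ℕ → Set
TakeFits (part k) l = k ≤ l
TakeFits skip _ = ⊤
TakeFits whole _ = ⊤

CutFits : Cut → List A → Set
CutFits (_ , t) w = TakeFits t (length w)

cutSegments : List A → Cut → List (Segment A)
cutSegments w (_ , skip) = (w , false) ∷ []
cutSegments w (_ , whole) = (w , true) ∷ []
cutSegments w (front , part k) = (take k w , true) ∷ (drop k w , false) ∷ []
cutSegments w (back , part k) = (take (length w ∸ k) w , false) ∷ (drop (length w ∸ k) w , true) ∷ []

cutMarks : Cut → List Bool
cutMarks (_ , skip) = false ∷ []
cutMarks (_ , whole) = true ∷ []
cutMarks (front , part _) = true ∷ false ∷ []
cutMarks (back , part _) = false ∷ true ∷ []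

flatten-cutSegments : (w : List A) (c : Cut) → flatten (cutSegments w c) ≡ w
flatten-cutSegments w (_ , skip) = ++-identityʳ w
flatten-cutSegments w (_ , whole) = ++-identityʳ w
flatten-cutSegments w (front , part k) = trans (cong (take k w ++_) (++-identityʳ _)) (take++drop≡id k w)
flatten-cutSegments w (back , part k) =
  trans (cong (take (length w ∸ k) w ++_) (++-identityʳ _)) (take++drop≡id (length w ∸ k) w)

segments : Vec (List A) n → Vec Cut n → List (Segment A)
segments [] [] = []
segments (w ∷ ws) (c ∷ cs) = cutSegments w c ++ segments ws cs

flatten-segments : (ws : Vec (List A) n) (cs : Vec Cut n) → flatten (segments ws cs) ≡ concat (toList ws)
flatten-segments [] [] = refl
flatten-segments (w ∷ ws) (c ∷ cs) =
  trans (flatten-++ (cutSegments w c) _) (cong₂ _++_ (flatten-cutSegments w c) (flatten-segments ws cs))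

-- The value and the mark of each segment: all that the check of a plan sees, whatever the blocks.
cells : Vec ℕ n → Vec Cut n → List (ℕ × Bool)
cells [] [] = []
cells (v ∷ vs) (c ∷ cs) = map (v ,_) (cutMarks c) ++ cells vs cs

marks-segments : (ws : Vec (List A) n) (vs : Vec ℕ n) (cs : Vec Cut n) →
                 marks (segments ws cs) ≡ map proj₂ (cells vs cs)
marks-segments [] [] [] = refl
marks-segments (w ∷ ws) (v ∷ vs) (c ∷ cs) =
  trans (map-++ proj₂ (cutSegments w c) (segments ws cs))
        (trans (cong₂ _++_ (marks-cut c) (marks-segments ws vs cs)) (sym (map-++ proj₂ (map (v ,_) (cutMarks c)) _)))
  where
    marks-cut : ∀ c → marks (cutSegments w c) ≡ map proj₂ (map (v ,_) (cutMarks c))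
    marks-cut (_ , skip) = refl
    marks-cut (_ , whole) = refl
    marks-cut (front , part _) = refl
    marks-cut (back , part _) = refl

valueCount : ℕ → Vec (List A) n → Vec ℕ n → Vec Cut n → ℕ
valueCount i [] [] [] = 0
valueCount i (w ∷ ws) (v ∷ vs) ((_ , t) ∷ cs) = (if v ≡ᵇ i then takeAmount t (length w) else 0) + valueCount i ws vs cs

valueCounts : Vec (List A) n → Vec ℕ n → Vec Cut n → Vec ℕ 4
valueCounts ws vs cs = Vec.map (λ i → valueCount i ws vs cs) (0 ∷ 1 ∷ 2 ∷ 3 ∷ [])

yesValue noValue : ℕ → Bool → ℕ
yesValue v b = (v + [ not b ]) ⊓ 4
noValue v b = (v + [ b ]) ⊓ 4

segmentRuns : (ℕ → Bool → ℕ) → ℕ → List (Segment A) → List Run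
segmentRuns f v = map (λ seg → length (proj₁ seg) , f v (proj₂ seg))

answerRuns : (ℕ → Bool → ℕ) → Vec (List A) n → Vec ℕ n → Vec Cut n → List Run
answerRuns f [] [] [] = []
answerRuns f (w ∷ ws) (v ∷ vs) (c ∷ cs) = segmentRuns f v (cutSegments w c) ++ answerRuns f ws vs cs

values-answerRuns : (f : ℕ → Bool → ℕ) (ws : Vec (List A) n) (vs : Vec ℕ n) (cs : Vec Cut n) →
                    map proj₂ (answerRuns f ws vs cs) ≡ map (λ cell → f (proj₁ cell) (proj₂ cell)) (cells vs cs)
values-answerRuns f [] [] [] = refl
values-answerRuns f (w ∷ ws) (v ∷ vs) (c ∷ cs) =
  trans (map-++ proj₂ (segmentRuns f v (cutSegments w c)) _)
        (trans (cong₂ _++_ (values-cut c) (values-answerRuns f ws vs cs)) (sym (map-++ _ (map (v ,_) (cutMarks c)) _)))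
  where
    values-cut : ∀ c → map proj₂ (segmentRuns f v (cutSegments w c)) ≡ map (λ cell → f (proj₁ cell) (proj₂ cell)) (map (v ,_) (cutMarks c))
    values-cut (_ , skip) = refl
    values-cut (_ , whole) = refl
    values-cut (front , part _) = refl
    values-cut (back , part _) = refl

answerValues : (ℕ → Bool → ℕ) → List (ℕ × Bool) → List ℕ
answerValues f cs = filter (_≤? 3) (map (λ cell → f (proj₁ cell) (proj₂ cell)) cs)

admissible : List (ℕ × Bool) → Bool
admissible cs = cyclicTrueRunsAtMost 4 (map proj₂ cs) ∧ wellShaped? (answerValues yesValue cs) ∧ wellShaped? (answerValues noValue cs)

countMarked : Bool → List (Segment A) → ℕ
countMarked c [] = 0
countMarked c ((w , b) ∷ segs) = (if b ∧ c then length w else 0) + countMarked c segs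

countMarked-cut : (c : Bool) (w : List A) (cut : Cut) → CutFits cut w →
                  countMarked c (cutSegments w cut) ≡ (if c then takeAmount (proj₂ cut) (length w) else 0)
countMarked-cut true w (_ , skip) _ = refl
countMarked-cut false w (_ , skip) _ = refl
countMarked-cut true w (_ , whole) _ = +-identityʳ (length w)
countMarked-cut false w (_ , whole) _ = refl
countMarked-cut true w (front , part k) k≤ = trans (+-identityʳ _) (trans (length-take k w) (m≤n⇒m⊓n≡m k≤))
countMarked-cut false w (front , part k) _ = refl
countMarked-cut true w (back , part k) k≤ = trans (+-identityʳ _) (trans (length-drop (length w ∸ k) w) (m∸[m∸n]≡n k≤))
countMarked-cut false w (back , part k) _ = refl

module _ (m : ℕ) (σ : State m) where

  Constant : ℕ → List (U m) → Set
  Constant v = All (λ y → σ y ≡ v)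

  cutSegments-constant : ∀ {v w} (c : Cut) → Constant v w → All (λ seg → Constant v (proj₁ seg)) (cutSegments w c)
  cutSegments-constant (_ , skip) h = h ∷ []
  cutSegments-constant (_ , whole) h = h ∷ []
  cutSegments-constant (front , part k) h = All.take⁺ k h ∷ All.drop⁺ k h ∷ []
  cutSegments-constant {w = w} (back , part k) h = All.take⁺ (length w ∸ k) h ∷ All.drop⁺ (length w ∸ k) h ∷ []

  count-support : (P : U m → Bool) → (∀ {y} → T (P y) → σ y ≤ 3) → ∀ {xs} → support m σ ↻ xs →
                  count m P ≡ length (filter (λ y → T? (P y)) xs)
  count-support P P⇒inSupport rot =
    trans (cong length (sym (filter-filter-⊆ (λ y → T? (P y)) (λ y → σ y ≤? 3) P⇒inSupport (elems m))))
          (sym (↻-length (↻-filter (λ y → T? (P y)) rot)))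

  count-segments : (Q : Question m) (i v : ℕ) (segs : List (Segment (U m))) →
                   All (λ seg → Constant v (proj₁ seg)) segs → Realises Q segs →
                   length (filter (λ y → T? (Q y ∧ (σ y ≡ᵇ i))) (flatten segs)) ≡ countMarked (v ≡ᵇ i) segs
  count-segments Q i v [] [] [] = refl
  count-segments Q i v ((w , b) ∷ segs) (const ∷ consts) (real ∷ reals) =
    trans (cong length (filter-++ (λ y → T? (Q y ∧ (σ y ≡ᵇ i))) w (flatten segs)))
          (trans (length-++ (filter (λ y → T? (Q y ∧ (σ y ≡ᵇ i))) w))
                 (cong₂ _+_ (length-filter-constant (λ y → Q y ∧ (σ y ≡ᵇ i)) (b ∧ (v ≡ᵇ i))
                               (All.zipWith (λ (σy≡v , Qy≡b) → cong₂ _∧_ Qy≡b (cong (_≡ᵇ i) σy≡v)) (const , real)))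
                            (count-segments Q i v segs consts reals)))

  count-blocks : (Q : Question m) (i : ℕ) (ws : Vec (List (U m)) n) (vs : Vec ℕ n) (cs : Vec Cut n) →
                 Pointwise (λ w v → Constant v w) ws vs → Pointwise CutFits cs ws → Realises Q (segments ws cs) →
                 length (filter (λ y → T? (Q y ∧ (σ y ≡ᵇ i))) (concat (toList ws))) ≡ valueCount i ws vs cs
  count-blocks Q i [] [] [] [] [] _ = refl
  count-blocks Q i (w ∷ ws) (v ∷ vs) (c ∷ cs) (const ∷ consts) (fit ∷ fits) reals
    with All.++⁻ (cutSegments w c) reals
  ... | realW , realWs =
    trans (cong length (filter-++ P? w (concat (toList ws))))
          (trans (length-++ (filter P? w))
                 (cong₂ _+_ block (count-blocks Q i ws vs cs consts fits realWs)))
    where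
      P? = λ y → T? (Q y ∧ (σ y ≡ᵇ i))
      block : length (filter P? w) ≡ (if v ≡ᵇ i then takeAmount (proj₂ c) (length w) else 0)
      block = trans (cong (length ∘ filter P?) (sym (flatten-cutSegments w c)))
                    (trans (count-segments Q i v (cutSegments w c) (cutSegments-constant c const) realW)
                           (countMarked-cut (v ≡ᵇ i) w c fit))

  counts-blocks : (Q : Question m) (ws : Vec (List (U m)) n) (vs : Vec ℕ n) (cs : Vec Cut n) →
                  support m σ ↻ concat (toList ws) → Pointwise (λ w v → Constant v w) ws vs →
                  Pointwise CutFits cs ws → Realises Q (segments ws cs) →
                  Vec.map (λ i → count m (λ y → Q y ∧ (σ y ≡ᵇ i))) (0 ∷ 1 ∷ 2 ∷ 3 ∷ []) ≡ valueCounts ws vs cs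
  counts-blocks Q ws vs cs rot consts fits reals =
    cong₂ _∷_ (counts 0 z≤n) (cong₂ _∷_ (counts 1 (s≤s z≤n))
      (cong₂ _∷_ (counts 2 (s≤s (s≤s z≤n))) (cong₂ _∷_ (counts 3 ≤-refl) refl)))
    where
      counts : ∀ i → i ≤ 3 → count m (λ y → Q y ∧ (σ y ≡ᵇ i)) ≡ valueCount i ws vs cs
      counts i i≤3 = trans (count-support (λ y → Q y ∧ (σ y ≡ᵇ i)) inSupport rot) (count-blocks Q i ws vs cs consts fits reals)
        where
          inSupport : ∀ {y} → T (Q y ∧ (σ y ≡ᵇ i)) → σ y ≤ 3
          inSupport {y} h = subst (_≤ 3) (sym (≡ᵇ⇒≡ (σ y) i (proj₂ (Equivalence.to T-∧ h)))) i≤3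

  stateType-blocks : (ws : Vec (List (U m)) n) (vs : Vec ℕ n) →
                     support m σ ↻ concat (toList ws) → Pointwise (λ w v → Constant v w) ws vs →
                     stateType m σ ≡ valueCounts ws vs (Vec.replicate n (front , whole))
  stateType-blocks ws vs rot consts =
    counts-blocks (λ _ → true) ws vs (Vec.replicate _ (front , whole)) rot consts (all-fit ws) (all-marked ws)
    where
      all-fit : ∀ {n} (ws : Vec (List (U m)) n) → Pointwise CutFits (Vec.replicate n (front , whole)) ws
      all-fit [] = []
      all-fit (w ∷ ws) = tt ∷ all-fit ws
      all-marked : ∀ {n} (ws : Vec (List (U m)) n) → Realises (λ _ → true) (segments ws (Vec.replicate n (front , whole)))
      all-marked [] = []
      all-marked (w ∷ ws) = All.universal (λ _ → refl) w ∷ all-marked ws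

  map-answer-segments : (f : ℕ → Bool → ℕ) (Q : Question m) (v : ℕ) (segs : List (Segment (U m))) →
                        All (λ seg → Constant v (proj₁ seg)) segs → Realises Q segs →
                        map (λ y → f (σ y) (Q y)) (flatten segs) ≡ expand (segmentRuns f v segs)
  map-answer-segments f Q v [] [] [] = refl
  map-answer-segments f Q v ((w , b) ∷ segs) (const ∷ consts) (real ∷ reals) =
    trans (map-++ (λ y → f (σ y) (Q y)) w (flatten segs))
          (cong₂ _++_ (map-≡-replicate (λ y → f (σ y) (Q y)) (f v b)
                         (All.zipWith (λ (σy≡v , Qy≡b) → cong₂ f σy≡v Qy≡b) (const , real)))
                      (map-answer-segments f Q v segs consts reals))

  map-answer : (f : ℕ → Bool → ℕ) (Q : Question m) (ws : Vec (List (U m)) n) (vs : Vec ℕ n) (cs : Vec Cut n) →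
               Pointwise (λ w v → Constant v w) ws vs → Realises Q (segments ws cs) →
               map (λ y → f (σ y) (Q y)) (concat (toList ws)) ≡ expand (answerRuns f ws vs cs)
  map-answer f Q [] [] [] [] _ = refl
  map-answer f Q (w ∷ ws) (v ∷ vs) (c ∷ cs) (const ∷ consts) reals with All.++⁻ (cutSegments w c) reals
  ... | realW , realWs =
    trans (map-++ (λ y → f (σ y) (Q y)) w (concat (toList ws)))
          (trans (cong₂ _++_ (trans (cong (map (λ y → f (σ y) (Q y))) (sym (flatten-cutSegments w c)))
                                    (map-answer-segments f Q v (cutSegments w c) (cutSegments-constant c const) realW))
                             (map-answer f Q ws vs cs consts realWs))
                 (sym (expand-++ (segmentRuns f v (cutSegments w c)) _)))

wellShaped-values : ∀ m (τ : State m) → WellShapedValues (map τ (support m τ)) → WellShaped m τ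
wellShaped-values m τ (ws , rot , shaped) with ↻⇒rotate rot
... | r , refl with shaped
...   | inj₁ (ℓ , eq) = r , ℓ , inj₁ (trans (map-rotate τ r (support m τ)) eq)
...   | inj₂ (ℓ , eq) = r , ℓ , inj₂ (trans (map-rotate τ r (support m τ)) eq)

answer-wellShaped : ∀ m (σ τ : State m) → (∀ {y} → τ y ≤ 3 → σ y ≤ 3) → ∀ {xs} → support m σ ↻ xs →
                    WellShapedValues (filter (_≤? 3) (map τ xs)) → WellShaped m τ
answer-wellShaped m σ τ τ⇒σ rot shaped =
  wellShaped-values m τ (subst WellShapedValues values-in-support
    (↻-WellShapedValues (↻-filter (_≤? 3) (↻-map τ rot)) shaped))
  where
    values-in-support : filter (_≤? 3) (map τ (support m σ)) ≡ map τ (support m τ)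
    values-in-support =
      trans (sym (map-filter τ (_≤? 3) (support m σ)))
            (cong (map τ) (filter-filter-⊆ (λ y → τ y ≤? 3) (λ y → σ y ≤? 3) τ⇒σ (elems m)))

plan-question : ∀ m (σ : State m) (ws : Vec (List (U m)) n) (vs : Vec ℕ n) (cs : Vec Cut n) →
                support m σ ↻ concat (toList ws) → Pointwise (λ w v → Constant m σ v w) ws vs →
                Pointwise CutFits cs ws → T (admissible (cells vs cs)) →
                Σ (Question m) λ Q → IsFourInterval m Q × WellShaped m (σyes m σ Q) × WellShaped m (σno m σ Q) ×
                  questionType m σ Q ≡ valueCounts ws vs cs
plan-question m σ ws vs cs rot consts fits ok
  with Equivalence.to T-∧ ok
... | intervalsOk , answersOk with Equivalence.to T-∧ answersOk
...   | yesOk , noOk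
  with four-intervals m (segments ws cs) (support-increasing m σ) (subst (_ ↻_) (sym (flatten-segments ws cs)) rot)
                      (subst (T ∘ cyclicTrueRunsAtMost 4) (sym (marks-segments ws vs cs)) intervalsOk)
...     | ivs , realises = Q , (ivs , λ _ → refl) , answer yesValue (λ {v} {b} → +⊓4≤3⇒≤3 v [ not b ]) yesOk ,
                             answer noValue (λ {v} {b} → +⊓4≤3⇒≤3 v [ b ]) noOk , counts
  where
    Q = unionOf m ivs

    answer : (f : ℕ → Bool → ℕ) → (∀ {v b} → f v b ≤ 3 → v ≤ 3) → T (wellShaped? (answerValues f (cells vs cs))) →
             WellShaped m (λ y → f (σ y) (Q y))
    answer f inSupport ok =
      answer-wellShaped m σ (λ y → f (σ y) (Q y)) inSupport rot
        (subst (WellShapedValues ∘ filter (_≤? 3)) (sym (map-answer m σ f Q ws vs cs consts realises))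
          (subst WellShapedValues (sym (filter-expand (_≤? 3) runs))
            (wellShaped?-sound (filter ((_≤? 3) ∘ proj₂) runs) (subst (T ∘ wellShaped?) (sym values) ok))))
      where
        runs = answerRuns f ws vs cs
        values : map proj₂ (filter ((_≤? 3) ∘ proj₂) runs) ≡ answerValues f (cells vs cs)
        values = trans (map-filter proj₂ (_≤? 3) runs) (cong (filter (_≤? 3)) (values-answerRuns f ws vs cs))

    counts : questionType m σ Q ≡ valueCounts ws vs cs
    counts = counts-blocks m σ Q ws vs cs rot consts fits realises

-- Well-shaped states of type (1, 1, c₂, d₂)

data Shape : Set where
  shape₁ shape₂ : Shape

patternOf : Shape → Vec ℕ 12
patternOf shape₁ = pattern₁
patternOf shape₂ = pattern₂

split-replicate : (f : A → ℕ) (xs : List A) (k v : ℕ) (rest : List ℕ) → map f xs ≡ replicate k v ++ rest →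
                  ∃₂ λ w xs′ → xs ≡ w ++ xs′ × All (λ y → f y ≡ v) w × map f xs′ ≡ rest
split-replicate f xs zero v rest eq = [] , xs , refl , [] , eq
split-replicate f (x ∷ xs) (suc k) v rest eq with ∷-injective eq
... | fx≡v , eq′ with split-replicate f xs k v rest eq′
...   | w , xs′ , refl , fw≡v , eq″ = x ∷ w , xs′ , refl , fx≡v ∷ fw≡v , eq″

split-blocks : (f : A → ℕ) (xs : List A) (ℓ p : Vec ℕ n) → map f xs ≡ blocksOf ℓ p →
               Σ (Vec (List A) n) λ ws → xs ≡ concat (toList ws) × Pointwise (λ w v → All (λ y → f y ≡ v) w) ws p
split-blocks f [] [] [] _ = [] , refl , []
split-blocks f (_ ∷ _) [] [] ()
split-blocks f xs (l ∷ ℓ) (q ∷ p) eq with split-replicate f xs l q (blocksOf ℓ p) eq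
... | w , xs′ , refl , fw≡q , eq′ with split-blocks f xs′ ℓ p eq′
...   | ws , refl , fws≡p = w ∷ ws , refl , fw≡q ∷ fws≡p

rotation-blocks : ∀ m (σ : State m) r (ℓ p : Vec ℕ n) → map σ (rotate r (support m σ)) ≡ blocksOf ℓ p →
                  Σ (Vec (List (U m)) n) λ ws →
                    support m σ ↻ concat (toList ws) × Pointwise (λ w v → Constant m σ v w) ws p
rotation-blocks m σ r ℓ p eq with split-blocks σ (rotate r (support m σ)) ℓ p eq
... | ws , rot≡ws , consts = ws , subst (support m σ ↻_) rot≡ws (↻-rotate r (support m σ)) , consts

wellShaped-blocks : ∀ m (σ : State m) → WellShaped m σ →
                    Σ Shape λ sh → Σ (Vec (List (U m)) 12) λ ws →
                      support m σ ↻ concat (toList ws) × Pointwise (λ w v → Constant m σ v w) ws (patternOf sh)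
wellShaped-blocks m σ (r , ℓ , inj₁ eq) = shape₁ , rotation-blocks m σ r ℓ pattern₁ eq
wellShaped-blocks m σ (r , ℓ , inj₂ eq) = shape₂ , rotation-blocks m σ r ℓ pattern₂ eq

zeroBlock : Vec A 12 → A
zeroBlock (_ ∷ _ ∷ w ∷ _) = w

twoBlocks : Vec A 12 → Vec A 5
twoBlocks (a ∷ _ ∷ _ ∷ _ ∷ b ∷ _ ∷ c ∷ _ ∷ d ∷ _ ∷ e ∷ _ ∷ []) = a ∷ b ∷ c ∷ d ∷ e ∷ []

threeBlocks : Shape → Vec A 12 → Vec A 3
threeBlocks shape₁ (_ ∷ _ ∷ _ ∷ _ ∷ _ ∷ x ∷ _ ∷ _ ∷ _ ∷ y ∷ _ ∷ z ∷ []) = x ∷ y ∷ z ∷ []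
threeBlocks shape₂ (_ ∷ _ ∷ _ ∷ _ ∷ _ ∷ _ ∷ _ ∷ x ∷ _ ∷ y ∷ _ ∷ z ∷ []) = x ∷ y ∷ z ∷ []

plan : Shape → Vec Take 5 → Vec Side 4 → Vec ℕ 3 → Vec Cut 12
plan shape₁ (ta ∷ tb ∷ tc ∷ td ∷ te ∷ []) (s ∷ s₁ ∷ s₂ ∷ s₃ ∷ []) (x₁ ∷ x₂ ∷ x₃ ∷ []) =
  (s , ta) ∷ (front , skip) ∷ (front , whole) ∷ (front , skip) ∷ (s , tb) ∷ (s₁ , part x₁) ∷
  (s , tc) ∷ (front , skip) ∷ (s , td) ∷ (s₂ , part x₂) ∷ (s , te) ∷ (s₃ , part x₃) ∷ []
plan shape₂ (ta ∷ tb ∷ tc ∷ td ∷ te ∷ []) (s ∷ s₁ ∷ s₂ ∷ s₃ ∷ []) (x₁ ∷ x₂ ∷ x₃ ∷ []) =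
  (s , ta) ∷ (front , skip) ∷ (front , whole) ∷ (front , skip) ∷ (s , tb) ∷ (front , skip) ∷
  (s , tc) ∷ (s₁ , part x₁) ∷ (s , td) ∷ (s₂ , part x₂) ∷ (s , te) ∷ (s₃ , part x₃) ∷ []

valueCounts-plan-lengths : ∀ sh ts o xs (ws : Vec (List A) 12) →
                   valueCounts ws (patternOf sh) (plan sh ts o xs) ≡
                     length (zeroBlock ws) + 0 ∷ 0 ∷ Vec.sum (zipWith takeAmount ts (Vec.map length (twoBlocks ws))) ∷ Vec.sum xs ∷ []
valueCounts-plan-lengths shape₁ (_ ∷ _ ∷ _ ∷ _ ∷ _ ∷ []) (_ ∷ _ ∷ _ ∷ _ ∷ []) (_ ∷ _ ∷ _ ∷ [])
                 (_ ∷ _ ∷ _ ∷ _ ∷ _ ∷ _ ∷ _ ∷ _ ∷ _ ∷ _ ∷ _ ∷ _ ∷ []) = refl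
valueCounts-plan-lengths shape₂ (_ ∷ _ ∷ _ ∷ _ ∷ _ ∷ []) (_ ∷ _ ∷ _ ∷ _ ∷ []) (_ ∷ _ ∷ _ ∷ [])
                 (_ ∷ _ ∷ _ ∷ _ ∷ _ ∷ _ ∷ _ ∷ _ ∷ _ ∷ _ ∷ _ ∷ _ ∷ []) = refl

plan-valueCounts : ∀ sh ts o xs (ws : Vec (List A) 12) {d} → length (zeroBlock ws) ≡ 1 →
                   Vec.sum (zipWith takeAmount ts (Vec.map length (twoBlocks ws))) ≡ 2 → Vec.sum xs ≡ d →
                   valueCounts ws (patternOf sh) (plan sh ts o xs) ≡ 1 ∷ 0 ∷ 2 ∷ d ∷ []
plan-valueCounts sh ts o xs ws zero≡1 twos≡2 threes≡d =
  trans (valueCounts-plan-lengths sh ts o xs ws)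
        (cong₂ _∷_ (trans (+-identityʳ _) zero≡1) (cong (0 ∷_) (cong₂ _∷_ twos≡2 (cong (_∷ []) threes≡d))))

plan-fits : ∀ sh ts o xs (ws : Vec (List A) 12) →
            Pointwise TakeFits ts (Vec.map length (twoBlocks ws)) → Pointwise _≤_ xs (Vec.map length (threeBlocks sh ws)) →
            Pointwise CutFits (plan sh ts o xs) ws
plan-fits shape₁ (_ ∷ _ ∷ _ ∷ _ ∷ _ ∷ []) (_ ∷ _ ∷ _ ∷ _ ∷ []) (_ ∷ _ ∷ _ ∷ [])
          (_ ∷ _ ∷ _ ∷ _ ∷ _ ∷ _ ∷ _ ∷ _ ∷ _ ∷ _ ∷ _ ∷ _ ∷ []) (fa ∷ fb ∷ fc ∷ fd ∷ fe ∷ []) (f₁ ∷ f₂ ∷ f₃ ∷ []) =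
  fa ∷ tt ∷ tt ∷ tt ∷ fb ∷ f₁ ∷ fc ∷ tt ∷ fd ∷ f₂ ∷ fe ∷ f₃ ∷ []
plan-fits shape₂ (_ ∷ _ ∷ _ ∷ _ ∷ _ ∷ []) (_ ∷ _ ∷ _ ∷ _ ∷ []) (_ ∷ _ ∷ _ ∷ [])
          (_ ∷ _ ∷ _ ∷ _ ∷ _ ∷ _ ∷ _ ∷ _ ∷ _ ∷ _ ∷ _ ∷ _ ∷ []) (fa ∷ fb ∷ fc ∷ fd ∷ fe ∷ []) (f₁ ∷ f₂ ∷ f₃ ∷ []) =
  fa ∷ tt ∷ tt ∷ tt ∷ fb ∷ tt ∷ fc ∷ f₁ ∷ fd ∷ f₂ ∷ fe ∷ f₃ ∷ []

valueCounts-lengths : ∀ sh (ws : Vec (List A) 12) {c₁ c₂ d₂} →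
                      valueCounts ws (patternOf sh) (Vec.replicate 12 (front , whole)) ≡ 1 ∷ c₁ ∷ c₂ ∷ d₂ ∷ [] →
                      length (zeroBlock ws) ≡ 1 × Vec.sum (Vec.map length (twoBlocks ws)) ≡ c₂ ×
                      Vec.sum (Vec.map length (threeBlocks sh ws)) ≡ d₂
valueCounts-lengths shape₁ (_ ∷ _ ∷ _ ∷ _ ∷ _ ∷ _ ∷ _ ∷ _ ∷ _ ∷ _ ∷ _ ∷ _ ∷ []) counts with ∷-injective₄ counts
... | zeros , _ , twos , threes = trans (sym (+-identityʳ _)) zeros , twos , threes
valueCounts-lengths shape₂ (_ ∷ _ ∷ _ ∷ _ ∷ _ ∷ _ ∷ _ ∷ _ ∷ _ ∷ _ ∷ _ ∷ _ ∷ []) counts with ∷-injective₄ counts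
... | zeros , _ , twos , threes = trans (sym (+-identityʳ _)) zeros , twos , threes

-- The blocks of value 2 (positions 0, 4, 6, 8, 10 of both patterns) are called a, b, c, d, e;
-- a selection names the blocks that provide the two cells of value 2 asked about.
data Selection : Set where
  aa ee dd cc ae ad ac ab be de ce cd bd bc bb : Selection

-- A block is taken whole only when it has at most one cell; taking an empty block whole changes
-- nothing but the marks seen by the check.
takes : Selection → Vec Take 5
takes aa = part 2 ∷ skip ∷ skip ∷ skip ∷ skip ∷ []
takes ee = skip ∷ skip ∷ skip ∷ skip ∷ part 2 ∷ []
takes dd = skip ∷ skip ∷ skip ∷ part 2 ∷ skip ∷ []
takes cc = skip ∷ skip ∷ part 2 ∷ skip ∷ skip ∷ []
takes ae = whole ∷ skip ∷ skip ∷ skip ∷ part 1 ∷ []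
takes ad = whole ∷ skip ∷ skip ∷ part 1 ∷ skip ∷ []
takes ac = whole ∷ skip ∷ part 1 ∷ skip ∷ skip ∷ []
takes ab = whole ∷ part 1 ∷ skip ∷ whole ∷ skip ∷ []
takes be = skip ∷ part 1 ∷ skip ∷ skip ∷ whole ∷ []
takes de = skip ∷ whole ∷ skip ∷ part 1 ∷ whole ∷ []
takes ce = skip ∷ skip ∷ part 1 ∷ skip ∷ whole ∷ []
takes cd = skip ∷ skip ∷ part 1 ∷ whole ∷ skip ∷ []
takes bd = skip ∷ part 1 ∷ skip ∷ whole ∷ skip ∷ []
takes bc = skip ∷ part 1 ∷ whole ∷ skip ∷ whole ∷ []
takes bb = skip ∷ part 2 ∷ skip ∷ skip ∷ whole ∷ []

-- The side of the partly taken block of value 2, then the sides of the three blocks of value 3.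
orientation : Shape → Selection → Vec Side 4
orientation shape₁ aa = front ∷ front ∷ front ∷ back ∷ []
orientation shape₁ ee = front ∷ front ∷ back ∷ front ∷ []
orientation shape₁ dd = back ∷ front ∷ front ∷ front ∷ []
orientation shape₁ cc = front ∷ back ∷ front ∷ front ∷ []
orientation shape₁ ae = front ∷ front ∷ back ∷ back ∷ []
orientation shape₁ ad = back ∷ front ∷ front ∷ back ∷ []
orientation shape₁ ac = front ∷ back ∷ front ∷ back ∷ []
orientation shape₁ ab = back ∷ front ∷ front ∷ back ∷ []
orientation shape₁ be = front ∷ front ∷ back ∷ front ∷ []
orientation shape₁ de = front ∷ front ∷ back ∷ front ∷ []
orientation shape₁ ce = back ∷ front ∷ back ∷ front ∷ []
orientation shape₁ cd = front ∷ back ∷ front ∷ front ∷ []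
orientation shape₁ bd = back ∷ front ∷ front ∷ front ∷ []
orientation shape₁ bc = front ∷ back ∷ back ∷ front ∷ []
orientation shape₁ bb = front ∷ front ∷ back ∷ front ∷ []
orientation shape₂ aa = front ∷ front ∷ front ∷ back ∷ []
orientation shape₂ ee = front ∷ front ∷ back ∷ front ∷ []
orientation shape₂ dd = front ∷ back ∷ front ∷ front ∷ []
orientation shape₂ cc = back ∷ front ∷ front ∷ front ∷ []
orientation shape₂ ae = front ∷ front ∷ back ∷ back ∷ []
orientation shape₂ ad = front ∷ back ∷ front ∷ back ∷ []
orientation shape₂ ac = back ∷ front ∷ front ∷ back ∷ []
orientation shape₂ ab = front ∷ back ∷ front ∷ back ∷ []
orientation shape₂ be = front ∷ front ∷ back ∷ front ∷ []
orientation shape₂ de = front ∷ back ∷ back ∷ front ∷ []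
orientation shape₂ ce = front ∷ front ∷ back ∷ front ∷ []
orientation shape₂ cd = front ∷ back ∷ front ∷ front ∷ []
orientation shape₂ bd = front ∷ back ∷ front ∷ front ∷ []
orientation shape₂ bc = front ∷ front ∷ back ∷ front ∷ []
orientation shape₂ bb = front ∷ front ∷ back ∷ front ∷ []

selectedPlan : Shape → Selection → Vec ℕ 3 → Vec Cut 12
selectedPlan sh sel = plan sh (takes sel) (orientation sh sel)

-- Decided by evaluation: the check does not look at x₁, x₂, x₃.
selectedPlan-admissible : ∀ sh sel {x₁ x₂ x₃} → T (admissible (cells (patternOf sh) (selectedPlan sh sel (x₁ ∷ x₂ ∷ x₃ ∷ []))))
selectedPlan-admissible shape₁ aa = _
selectedPlan-admissible shape₁ ee = _
selectedPlan-admissible shape₁ dd = _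
selectedPlan-admissible shape₁ cc = _
selectedPlan-admissible shape₁ ae = _
selectedPlan-admissible shape₁ ad = _
selectedPlan-admissible shape₁ ac = _
selectedPlan-admissible shape₁ ab = _
selectedPlan-admissible shape₁ be = _
selectedPlan-admissible shape₁ de = _
selectedPlan-admissible shape₁ ce = _
selectedPlan-admissible shape₁ cd = _
selectedPlan-admissible shape₁ bd = _
selectedPlan-admissible shape₁ bc = _
selectedPlan-admissible shape₁ bb = _
selectedPlan-admissible shape₂ aa = _
selectedPlan-admissible shape₂ ee = _
selectedPlan-admissible shape₂ dd = _
selectedPlan-admissible shape₂ cc = _
selectedPlan-admissible shape₂ ae = _
selectedPlan-admissible shape₂ ad = _
selectedPlan-admissible shape₂ ac = _
selectedPlan-admissible shape₂ ab = _
selectedPlan-admissible shape₂ be = _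
selectedPlan-admissible shape₂ de = _
selectedPlan-admissible shape₂ ce = _
selectedPlan-admissible shape₂ cd = _
selectedPlan-admissible shape₂ bd = _
selectedPlan-admissible shape₂ bc = _
selectedPlan-admissible shape₂ bb = _

Selectable : Selection → Vec ℕ 5 → Set
Selectable sel ls = Pointwise TakeFits (takes sel) ls × Vec.sum (zipWith takeAmount (takes sel) ls) ≡ 2

select : (ls : Vec ℕ 5) → 2 ≤ Vec.sum ls → Σ Selection λ sel → Selectable sel ls
select (suc (suc _) ∷ _ ∷ _ ∷ _ ∷ _ ∷ []) _ = aa , (s≤s (s≤s z≤n) ∷ tt ∷ tt ∷ tt ∷ tt ∷ []) , refl
select (_ ∷ _ ∷ _ ∷ _ ∷ suc (suc _) ∷ []) _ = ee , (tt ∷ tt ∷ tt ∷ tt ∷ s≤s (s≤s z≤n) ∷ []) , refl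
select (_ ∷ _ ∷ _ ∷ suc (suc _) ∷ _ ∷ []) _ = dd , (tt ∷ tt ∷ tt ∷ s≤s (s≤s z≤n) ∷ tt ∷ []) , refl
select (_ ∷ _ ∷ suc (suc _) ∷ _ ∷ _ ∷ []) _ = cc , (tt ∷ tt ∷ s≤s (s≤s z≤n) ∷ tt ∷ tt ∷ []) , refl
select (1 ∷ _ ∷ _ ∷ _ ∷ 1 ∷ []) _ = ae , (tt ∷ tt ∷ tt ∷ tt ∷ s≤s z≤n ∷ []) , refl
select (1 ∷ _ ∷ _ ∷ 1 ∷ 0 ∷ []) _ = ad , (tt ∷ tt ∷ tt ∷ s≤s z≤n ∷ tt ∷ []) , refl
select (1 ∷ _ ∷ 1 ∷ 0 ∷ 0 ∷ []) _ = ac , (tt ∷ tt ∷ s≤s z≤n ∷ tt ∷ tt ∷ []) , refl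
select (1 ∷ suc _ ∷ 0 ∷ 0 ∷ 0 ∷ []) _ = ab , (tt ∷ s≤s z≤n ∷ tt ∷ tt ∷ tt ∷ []) , refl
select (0 ∷ suc _ ∷ _ ∷ _ ∷ 1 ∷ []) _ = be , (tt ∷ s≤s z≤n ∷ tt ∷ tt ∷ tt ∷ []) , refl
select (0 ∷ 0 ∷ _ ∷ 1 ∷ 1 ∷ []) _ = de , (tt ∷ tt ∷ tt ∷ s≤s z≤n ∷ tt ∷ []) , refl
select (0 ∷ 0 ∷ 1 ∷ 0 ∷ 1 ∷ []) _ = ce , (tt ∷ tt ∷ s≤s z≤n ∷ tt ∷ tt ∷ []) , refl
select (0 ∷ _ ∷ 1 ∷ 1 ∷ 0 ∷ []) _ = cd , (tt ∷ tt ∷ s≤s z≤n ∷ tt ∷ tt ∷ []) , refl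
select (0 ∷ suc _ ∷ 0 ∷ 1 ∷ 0 ∷ []) _ = bd , (tt ∷ s≤s z≤n ∷ tt ∷ tt ∷ tt ∷ []) , refl
select (0 ∷ suc _ ∷ 1 ∷ 0 ∷ 0 ∷ []) _ = bc , (tt ∷ s≤s z≤n ∷ tt ∷ tt ∷ tt ∷ []) , refl
select (0 ∷ b ∷ 0 ∷ 0 ∷ 0 ∷ []) 2≤b = bb , (tt ∷ subst (2 ≤_) (+-identityʳ b) 2≤b ∷ tt ∷ tt ∷ tt ∷ []) , refl
select (1 ∷ 0 ∷ 0 ∷ 0 ∷ 0 ∷ []) (s≤s ())
select (0 ∷ 0 ∷ 1 ∷ 0 ∷ 0 ∷ []) (s≤s ())
select (0 ∷ 0 ∷ 0 ∷ 1 ∷ 0 ∷ []) (s≤s ())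
select (0 ∷ 0 ∷ 0 ∷ 0 ∷ 1 ∷ []) (s≤s ())

lemma5 : (m : ℕ) (σ : State m) → (∀ y → σ y ≤ 4) → WellShaped m σ →
         (c₂ d₂ : ℕ) → stateType m σ ≡ 1 ∷ 1 ∷ c₂ ∷ d₂ ∷ [] → 2 ≤ c₂ →
         (d : ℕ) → d ≤ d₂ →
         Σ (Question m) λ Q →
           IsFourInterval m Q × questionType m σ Q ≡ 1 ∷ 0 ∷ 2 ∷ d ∷ [] ×
           WellShaped m (σyes m σ Q) × WellShaped m (σno m σ Q)
lemma5 m σ _ shaped c₂ d₂ type 2≤c₂ d d≤d₂ with wellShaped-blocks m σ shaped
... | sh , ws , rot , consts
  with valueCounts-lengths sh ws (trans (sym (stateType-blocks m σ ws (patternOf sh) rot consts)) type)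
...   | zero≡1 , twos≡c₂ , threes≡d₂
  with select (Vec.map length (twoBlocks ws)) (subst (2 ≤_) (sym twos≡c₂) 2≤c₂)
     | ≤-sum-split d (Vec.map length (threeBlocks sh ws)) (subst (d ≤_) (sym threes≡d₂) d≤d₂)
...     | sel , twoFits , twos≡2 | xs@(x₁ ∷ x₂ ∷ x₃ ∷ []) , threeFits , threes≡d =
  let (Q , fourInterval , yesShaped , noShaped , type≡) =
        plan-question m σ ws (patternOf sh) (selectedPlan sh sel xs) rot consts
          (plan-fits sh (takes sel) (orientation sh sel) xs ws twoFits threeFits)
          (selectedPlan-admissible sh sel {x₁} {x₂} {x₃})
  in Q , fourInterval , trans type≡ (plan-valueCounts sh (takes sel) (orientation sh sel) xs ws zero≡1 twos≡2 threes≡d) ,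
     yesShaped , noShaped
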